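{- Let $A$ be a (finite) string over $\{0,1,2\}$. Then there exists $N\ge 0$ such that for all $n\ge N$, every run in $A_n$ has length at most $7$.
   Context: A run is a maximal block of consecutive equal digits. The base-3 look-and-say operation sends a string $A$, written as its runs $r_1\cdots r_k$ with $r_i$ consisting of $n_i$ copies of the digit $d_i$, to the string $A_1$ obtained by replacing each $r_i$ by the base-3 representation of $n_i$ (no leading zeros) followed by $d_i$, and concatenating; $A_0=A$, $A_{n+1}=(A_n)_1$. -}

module Defs where

open import Data.Nat using (ℕ; zero; suc; _≤_; _≟_)
open import Data.Nat.DivMod using (_/_; _%_)
open import Data.Fin using (Fin; _≟_) renaming (zero to f0; suc to fs)
open import Data.Fin using () renaming (_≟_ to _≟ᶠ_)
open import Data.List using (List; []; _∷_; _++_; concatMap; reverse)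
open import Data.List.Relation.Unary.All using (All)
open import Data.Product using (_×_; _,_; proj₁)
open import Relation.Nullary using (yes; no)
open import Function using (_∘_)

Digit : Set
Digit = Fin 3

String3 : Set
String3 = List Digit

-- Run-length decomposition: the list of maximal runs, each recorded as
-- (length n_i , digit d_i), in order.  Every recorded length is ≥ 1.
runs : String3 → List (ℕ × Digit)
runs [] = []
runs (d ∷ s) with runs s
... | [] = (1 , d) ∷ []
... | (n , e) ∷ rs with d ≟ᶠ e
...   | yes _ = (suc n , e) ∷ rs
...   | no  _ = (1 , d) ∷ (n , e) ∷ rs

digitOf : ℕ → Digit
digitOf n with n % 3
... | 0 = f0
... | 1 = fs f0
... | _ = fs (fs f0)

-- Base-3 digits of n, least significant first; fuel bounds the number of
-- digits (fuel ≥ n suffices).  Gives [] for n = 0.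
base3-rev : ℕ → ℕ → List Digit
base3-rev zero    _ = []
base3-rev (suc f) zero = []
base3-rev (suc f) (suc m) = digitOf (suc m) ∷ base3-rev f (suc m / 3)

-- Base-3 representation of n without leading zeros (most significant first).
-- For n ≥ 1 (the only case used: run lengths are positive) this is the
-- usual representation.
base3 : ℕ → List Digit
base3 n = reverse (base3-rev n n)

lookAndSay : String3 → String3
lookAndSay A = concatMap (λ r → base3 (proj₁ r) ++ (Data.Product.proj₂ r ∷ [])) (runs A)

iterate : ℕ → String3 → String3
iterate zero    A = A
iterate (suc n) A = lookAndSay (iterate n A)

RunsAtMost : ℕ → String3 → Set
RunsAtMost k A = All (λ r → proj₁ r ≤ k) (runs A)

-- If all runs of A have length ≤ k < 3^j, then A₁ is a concatenation of blocks
-- (numeral of at most j digits)·d_i in which consecutive d_i differ.  A run of A₁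
-- therefore covers at most the tail of one numeral, its digit d_i and one whole
-- following numeral, so it has length ≤ 2j + 1.  For the least such j this bound
-- is ≤ max 7 (k − 1): the maximal run length drops by one per step until it is
-- at most 7, and 7 < 3² keeps it there.
module Submission where

open import Defs
open import Data.Nat using (ℕ; zero; suc; _+_; _*_; _∸_; _^_; _≤_; _<_; _≥_; _⊔_; pred; z≤n; s≤s; _<?_)
open import Data.Nat.Properties
open import Data.Nat.DivMod using (_/_; m<n*o⇒m/o<n)
open import Data.Fin using () renaming (_≟_ to _≟ᶠ_)
open import Data.List using (List; []; _∷_; _++_; length; concatMap; map)
open import Data.List.Properties using (length-reverse; ++-assoc)
open import Data.List.Extrema.Nat using (max; xs≤max)
open import Data.List.Relation.Unary.All as All using (All; []; _∷_)
open import Data.List.Relation.Unary.All.Properties using (map⁻)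
open import Data.List.Relation.Unary.Linked as Linked using (Linked; []; [-]; _∷_)
open import Data.Product using (_×_; _,_; proj₁; proj₂; ∃-syntax)
open import Data.Sum using (inj₁; inj₂)
open import Data.Unit using (⊤; tt)
open import Data.Empty using (⊥-elim)
open import Relation.Nullary using (yes; no)
open import Relation.Nullary.Decidable using (from-yes)
open import Relation.Binary.PropositionalEquality

leading : Digit → String3 → ℕ
leading d [] = 0
leading d (e ∷ s) with d ≟ᶠ e
... | yes _ = suc (leading d s)
... | no _ = 0

leading-++ : ∀ x u v → leading x (u ++ v) ≤ length u + leading x v
leading-++ x [] v = ≤-refl
leading-++ x (e ∷ u) v with x ≟ᶠ e
... | yes _ = s≤s (leading-++ x u v)
... | no _ = z≤n

leading-∷ : ∀ x d s → leading x (d ∷ s) ≤ suc (leading d s)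
leading-∷ x d s with x ≟ᶠ d
... | yes refl = ≤-refl
... | no _ = z≤n

leading-≢ : ∀ {x d} s → x ≢ d → leading x (d ∷ s) ≡ 0
leading-≢ {x} {d} s x≢d with x ≟ᶠ d
... | yes x≡d = ⊥-elim (x≢d x≡d)
... | no _ = refl

-- Bounds the block starting at every position, not only at run starts, so that it
-- can be established piece by piece along _++_.
BlocksAtMost : ℕ → String3 → Set
BlocksAtMost k [] = ⊤
BlocksAtMost k (d ∷ s) = suc (leading d s) ≤ k × BlocksAtMost k s

blocksAtMost-++ : ∀ {k} u v → BlocksAtMost k v → (∀ x → length u + leading x v ≤ k) →
                  BlocksAtMost k (u ++ v)
blocksAtMost-++ [] v bv _ = bv
blocksAtMost-++ (x ∷ u) v bv short =
  ≤-trans (s≤s (leading-++ x u v)) (short x) ,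
  blocksAtMost-++ u v bv (λ y → <⇒≤ (short y))

runs-∷ : ∀ d s → ∃[ rs ] runs (d ∷ s) ≡ (suc (leading d s) , d) ∷ rs
runs-∷ d [] = [] , refl
runs-∷ d (e ∷ s) with runs-∷ e s
... | rs , eq rewrite eq with d ≟ᶠ e
...   | yes refl = rs , refl
...   | no _ = _ , refl

blocksAtMost⇒runsAtMost : ∀ {k} s → BlocksAtMost k s → RunsAtMost k s
blocksAtMost⇒runsAtMost [] _ = []
blocksAtMost⇒runsAtMost (d ∷ []) (first , _) = first ∷ []
blocksAtMost⇒runsAtMost (d ∷ e ∷ s) (first , rest)
  with runs (e ∷ s) | runs-∷ e s | blocksAtMost⇒runsAtMost (e ∷ s) rest
... | _ | rs , refl | ih with d ≟ᶠ e
...   | yes refl = first ∷ All.tail ih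
...   | no _ = first ∷ ih

DifferentDigits : ℕ × Digit → ℕ × Digit → Set
DifferentDigits r r′ = proj₂ r ≢ proj₂ r′

runs-linked : ∀ s → Linked DifferentDigits (runs s)
runs-linked [] = []
runs-linked (d ∷ s) with runs s | runs-linked s
... | [] | _ = [-]
... | (n , e) ∷ rs | linked with d ≟ᶠ e
...   | no d≢e = d≢e ∷ linked
...   | yes _ with linked
...     | [-] = [-]
...     | e≢r ∷ linked′ = e≢r ∷ linked′

length-base3-rev : ∀ fuel m j → m < 3 ^ j → length (base3-rev fuel m) ≤ j
length-base3-rev zero m j _ = z≤n
length-base3-rev (suc fuel) zero j _ = z≤n
length-base3-rev (suc fuel) (suc m) zero (s≤s ())
length-base3-rev (suc fuel) (suc m) (suc j) m<3^[1+j] =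
  s≤s (length-base3-rev fuel (suc m / 3) j
        (m<n*o⇒m/o<n (subst (suc m <_) (*-comm 3 (3 ^ j)) m<3^[1+j])))

length-base3 : ∀ n j → n < 3 ^ j → length (base3 n) ≤ j
length-base3 n j n<3^j rewrite length-reverse (base3-rev n n) = length-base3-rev n n j n<3^j

say : ℕ × Digit → String3
say (n , d) = base3 n ++ d ∷ []

say-∷ : ∀ n d rs → concatMap say ((n , d) ∷ rs) ≡ base3 n ++ d ∷ concatMap say rs
say-∷ n d rs = ++-assoc (base3 n) (d ∷ []) (concatMap say rs)

NumeralsAtMost : ℕ → List (ℕ × Digit) → Set
NumeralsAtMost j = All (λ r → length (base3 (proj₁ r)) ≤ j)

leading-concatMap-say : ∀ {j n d} rs → NumeralsAtMost j rs → Linked DifferentDigits ((n , d) ∷ rs) →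
               leading d (concatMap say rs) ≤ j
leading-concatMap-say [] _ _ = z≤n
leading-concatMap-say {j} {d = d} ((m , e) ∷ rs) (short ∷ _) (d≢e ∷ _) = begin
  leading d (concatMap say ((m , e) ∷ rs))      ≡⟨ cong (leading d) (say-∷ m e rs) ⟩
  leading d (base3 m ++ e ∷ concatMap say rs)  ≤⟨ leading-++ d (base3 m) _ ⟩
  length (base3 m) + leading d (e ∷ concatMap say rs)
    ≡⟨ cong (length (base3 m) +_) (leading-≢ (concatMap say rs) d≢e) ⟩
  length (base3 m) + 0                          ≡⟨ +-identityʳ _ ⟩
  length (base3 m)                              ≤⟨ short ⟩
  j                                             ∎
  where open ≤-Reasoning

blocksAtMost-concatMap-say : ∀ {j} rs → NumeralsAtMost j rs → Linked DifferentDigits rs →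
                    BlocksAtMost (j + suc j) (concatMap say rs)
blocksAtMost-concatMap-say [] _ _ = tt
blocksAtMost-concatMap-say {j} ((n , d) ∷ rs) (short ∷ shorts) linked rewrite say-∷ n d rs =
  blocksAtMost-++ (base3 n) (d ∷ concatMap say rs)
    (≤-trans (s≤s next) (m≤n+m (suc j) j) , blocksAtMost-concatMap-say rs shorts (Linked.tail linked))
    (λ x → +-mono-≤ short (≤-trans (leading-∷ x d (concatMap say rs)) (s≤s next)))
  where
  next : leading d (concatMap say rs) ≤ j
  next = leading-concatMap-say rs shorts linked

runsAtMost-lookAndSay : ∀ {k} j A → k < 3 ^ j → RunsAtMost k A → RunsAtMost (j + suc j) (lookAndSay A)
runsAtMost-lookAndSay j A k<3^j bounded =
  blocksAtMost⇒runsAtMost (lookAndSay A)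
    (blocksAtMost-concatMap-say (runs A) (All.map (λ n≤k → length-base3 _ j (≤-<-trans n≤k k<3^j)) bounded)
      (runs-linked A))

runsAtMost-mono : ∀ {k k′} A → k ≤ k′ → RunsAtMost k A → RunsAtMost k′ A
runsAtMost-mono A k≤k′ = All.map (λ n≤k → ≤-trans n≤k k≤k′)

3+2j<3^j : ∀ j → 2 ≤ j → suc j + suc (suc j) < 3 ^ j
3+2j<3^j 1 (s≤s ())
3+2j<3^j 2 _ = from-yes (7 <? 9)
3+2j<3^j (suc j@(suc (suc _))) _ = begin-strict
  suc (suc j) + suc (suc (suc j))  ≡⟨ cong suc (+-suc (suc j) (suc (suc j))) ⟩
  2 + (suc j + suc (suc j))        <⟨ +-monoʳ-< 2 (3+2j<3^j j (s≤s (s≤s z≤n))) ⟩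
  2 + 3 ^ j                        ≤⟨ +-monoˡ-≤ (3 ^ j) (*-monoʳ-≤ 2 (m^n>0 3 j)) ⟩
  2 * 3 ^ j + 3 ^ j                ≡⟨ +-comm (2 * 3 ^ j) (3 ^ j) ⟩
  3 * 3 ^ j                        ∎
  where open ≤-Reasoning

small-exponent-at-power : ∀ j k → suc k ≡ 3 ^ j → suc j + suc (suc j) ≤ 7 ⊔ k
small-exponent-at-power 0 k _ = ≤-trans (from-yes (3 ≤? 7)) (m≤m⊔n 7 k)
small-exponent-at-power 1 k _ = ≤-trans (from-yes (5 ≤? 7)) (m≤m⊔n 7 k)
small-exponent-at-power j@(suc (suc _)) k 1+k≡3^j =
  ≤-trans (≤-pred (subst (suc j + suc (suc j) <_) (sym 1+k≡3^j) (3+2j<3^j j (s≤s (s≤s z≤n)))))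
    (m≤n⊔m 7 k)

small-exponent : ∀ k → ∃[ j ] k < 3 ^ j × j + suc j ≤ 7 ⊔ pred k
small-exponent zero = 2 , from-yes (0 <? 9) , from-yes (5 ≤? 7)
small-exponent (suc k) with small-exponent k
... | j , k<3^j , small with m≤n⇒m<n∨m≡n k<3^j
...   | inj₁ 1+k<3^j = j , 1+k<3^j , ≤-trans small (⊔-monoʳ-≤ 7 (pred[n]≤n {k}))
...   | inj₂ 1+k≡3^j =
  suc j , subst (_< 3 ^ suc j) (sym 1+k≡3^j) (^-monoʳ-< 3 (from-yes (1 <? 3)) (n<1+n j)) ,
  small-exponent-at-power j k 1+k≡3^j

iterate-lookAndSay : ∀ n A → iterate n (lookAndSay A) ≡ iterate (suc n) A
iterate-lookAndSay zero A = refl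
iterate-lookAndSay (suc n) A = cong lookAndSay (iterate-lookAndSay n A)

runsAtMost-iterate : ∀ n {k} A → k ≤ 7 + n → RunsAtMost k A → RunsAtMost 7 (iterate n A)
runsAtMost-iterate zero A k≤7 bounded = runsAtMost-mono A k≤7 bounded
runsAtMost-iterate (suc n) {k} A k≤7+[1+n] bounded with small-exponent k
... | j , k<3^j , small =
  subst (RunsAtMost 7) (iterate-lookAndSay n A)
    (runsAtMost-iterate n (lookAndSay A) (≤-trans small next≤7+n)
      (runsAtMost-lookAndSay j A k<3^j bounded))
  where
  next≤7+n : 7 ⊔ pred k ≤ 7 + n
  next≤7+n = ⊔-lub (m≤m+n 7 n) (≤-trans (pred-mono-≤ k≤7+[1+n]) (≤-reflexive (+-suc 6 n)))

lemma2 : (A : String3) → ∃[ N ] ((n : ℕ) → n ≥ N → RunsAtMost 7 (iterate n A))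
lemma2 A = k ∸ 7 , λ n k∸7≤n →
  runsAtMost-iterate n A (≤-trans (m≤n+m∸n k 7) (+-monoʳ-≤ 7 k∸7≤n)) (map⁻ (xs≤max 0 lengths))
  where
  lengths : List ℕ
  lengths = map proj₁ (runs A)
  k : ℕ
  k = max 0 lengths
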